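{- Let $X$ be an obstruction containing arcs and let $v_1,v_2,\dots,v_n$ be a straight enumeration of $U(X)$. Suppose that $v_c$ is a non-dividing cut-vertex of $U(X)$. Then $c=2$ or $c=n-1$. Moreover, if $v_c$ is incident with both arcs of $X$, then $n=4$.
   Context: A partially oriented graph $H=(V,E\cup A)$ is obtained from a simple graph $G$ (its underlying graph $U(H)=G$) by orienting some of its edges; $E$ = unoriented edges, $A$ = arcs $(u,v)$. A local tournament is an oriented graph in which the in- and out-neighbourhood of every vertex each induce a tournament. $H$ can be completed to a local tournament if its unoriented edges can be oriented to give a local tournament. An obstruction is a partially oriented graph $X$ that cannot be completed to a local tournament, while $X-v$ can for every vertex $v$, and for every arc $(u,v)$ the graph obtained by replacing $(u,v)$ with the edge $uv$ can. An obstruction containing arcs contains exactly two arcs. A straight enumeration of a graph $G$ is an ordering $v_1,\dots,v_n$ of its vertices such that whenever $i<j<k$ and $v_iv_k\in E(G)$, both $v_iv_j$ and $v_jv_k$ are edges. A cut-vertex $v$ of $U(X)$ is dividing if one of the two arcs of $X$ is incident with a vertex preceding $v$ and the other with a vertex succeeding $v$ in the enumeration; otherwise non-dividing. -}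

module Defs where

open import Data.Nat using (ℕ)
open import Data.Fin using (Fin; _<_)
open import Data.Product using (Σ; _×_; ∃; ∃-syntax; _,_)
open import Data.Sum using (_⊎_)
open import Data.Empty using (⊥)
open import Data.Unit using (⊤)
open import Relation.Nullary using (¬_)
open import Relation.Binary.PropositionalEquality using (_≡_; _≢_)
open import Function.Definitions using (Bijective)

-- A partially oriented graph on the vertex set Fin n.
-- adj = adjacency of the underlying simple graph U(H);
-- arc u v = (u,v) is an arc; adjacent pairs that carry no arc are the
-- unoriented edges.
record POG (n : ℕ) : Set₁ where
  field
    adj      : Fin n → Fin n → Set
    arc      : Fin n → Fin n → Set
    adj-sym  : ∀ {u v} → adj u v → adj v u
    adj-irr  : ∀ {u} → ¬ adj u u
    arc-adj  : ∀ {u v} → arc u v → adj u v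
    arc-asym : ∀ {u v} → arc u v → ¬ arc v u
open POG public

VSet : ℕ → Set₁
VSet n = Fin n → Set

everything : ∀ {n} → VSet n
everything _ = ⊤

minus : ∀ {n} → Fin n → VSet n
minus v x = x ≢ v

-- O is a completion of the subgraph of H induced by S to a local tournament:
-- O is an orientation of U(H)[S] (every edge gets exactly one direction,
-- no other pairs), extending the arcs of H[S], and in- and out-neighbourhoods
-- (within S) of every vertex of S induce tournaments, i.e. are pairwise adjacent.
record IsLocalTournamentCompletion {n} (H : POG n) (S : VSet n)
       (O : Fin n → Fin n → Set) : Set where
  field
    O-in-S   : ∀ {u v} → O u v → S u × S v
    O-adj    : ∀ {u v} → O u v → adj H u v
    O-total  : ∀ {u v} → S u → S v → adj H u v → O u v ⊎ O v u
    O-asym   : ∀ {u v} → O u v → ¬ O v u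
    O-arc    : ∀ {u v} → S u → S v → arc H u v → O u v
    O-out    : ∀ {w x y} → x ≢ y → O w x → O w y → adj H x y
    O-in     : ∀ {w x y} → x ≢ y → O x w → O y w → adj H x y

CompletableOn : ∀ {n} → POG n → VSet n → Set₁
CompletableOn H S = ∃[ O ] IsLocalTournamentCompletion H S O

Completable : ∀ {n} → POG n → Set₁
Completable H = CompletableOn H everything

unorient : ∀ {n} → POG n → Fin n → Fin n → POG n
unorient H a b = record
  { adj = adj H
  ; arc = λ u v → arc H u v × ¬ (u ≡ a × v ≡ b)
  ; adj-sym = adj-sym H
  ; adj-irr = adj-irr H
  ; arc-adj = λ { (p , _) → arc-adj H p }
  ; arc-asym = λ { (p , _) (q , _) → arc-asym H p q }
  }

record Obstruction {n} (X : POG n) : Set₁ where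
  field
    not-completable : ¬ Completable X
    minus-vertex    : ∀ v → CompletableOn X (minus v)
    minus-arc       : ∀ {a b} → arc X a b → Completable (unorient X a b)

ContainsArcs : ∀ {n} → POG n → Set
ContainsArcs X = ∃[ u ] ∃[ v ] arc X u v

data Reach {n} (H : POG n) (S : VSet n) : Fin n → Fin n → Set where
  here : ∀ {x} → S x → Reach H S x x
  step : ∀ {x y z} → S x → adj H x y → Reach H S y z → Reach H S x z

-- v is a cut-vertex of U(H): removing v disconnects two vertices that were
-- connected (the number of components increases).
IsCutVertex : ∀ {n} → POG n → Fin n → Set
IsCutVertex H v = ∃[ x ] ∃[ y ]
  (x ≢ v × y ≢ v × Reach H everything x y × ¬ Reach H (minus v) x y)

-- Straight enumeration: σ i is the (i+1)-st vertex v_{i+1}.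
IsStraightEnumeration : ∀ {n} → POG n → (Fin n → Fin n) → Set
IsStraightEnumeration H σ =
  Bijective _≡_ _≡_ σ ×
  (∀ i j k → i < j → j < k → adj H (σ i) (σ k) →
     adj H (σ i) (σ j) × adj H (σ j) (σ k))

Precedes : ∀ {n} → (Fin n → Fin n) → Fin n → Fin n → Set
Precedes σ x c = ∃[ i ] (i < c × σ i ≡ x)

Succeeds : ∀ {n} → (Fin n → Fin n) → Fin n → Fin n → Set
Succeeds σ x c = ∃[ i ] (c < i × σ i ≡ x)

IncidentWith : ∀ {n} → (Fin n → Set) → Fin n → Fin n → Set
IncidentWith P u v = P u ⊎ P v

Dividing : ∀ {n} → POG n → (Fin n → Fin n) → Fin n → Set
Dividing X σ c = ∃[ a ] ∃[ b ] ∃[ a' ] ∃[ b' ]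
  (arc X a b × arc X a' b' × ¬ (a ≡ a' × b ≡ b') ×
   IncidentWith (λ x → Precedes σ x c) a b ×
   IncidentWith (λ x → Succeeds σ x c) a' b')

-- In a straight enumeration a cut vertex v_c separates the vertices before it from those after it: no edge
-- crosses v_c, and v_c has neighbours on both sides. If 2 < c < n − 1, delete a vertex before v_c (keeping
-- v_{c−1}) resp. after v_c (keeping v_{c+1}); the completions of what remains, restricted to the two sides of
-- v_c, make v_c a sink or a source on each side, since v_c keeps a neighbour on the far side that no other
-- vertex of the near side sees. Non-dividing means all arcs lie on one side, so the completion of the other
-- side may be reversed until v_c is a sink on one side and a source on the other; the two then glue to a
-- completion of X. If every arc meets v_c, some neighbour t of v_c on the far side is nonadjacent to both
-- other arc ends x, y. Two arcs pointing the same way at v_c then block the completion of X with one arc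
-- unoriented, while for a path y → v_c → x the configuration survives in X − z for every z ∉ {v_c, x, y, t}.
module Submission where

open import Defs
open import Data.Nat as ℕ using (ℕ; suc; pred; _∸_; _<_; _≤_; s≤s; >-nonZero)
open import Data.Nat.Properties
  using ( <-cmp; <-irrefl; <-asym; <-trans; <⇒≢; <⇒≱; ≮⇒≥; <⇒≤pred; m<n⇒0<n; n<1+n; suc-pred
        ; ≤-reflexive; ≤-antisym; ≤-total; ≤-<-trans; m≤n⇒m<n∨m≡n; ≤∧≢⇒<)
open import Data.Fin using (Fin; toℕ; fromℕ<; _≟_)
open import Data.Fin.Patterns using (0F; 1F; 2F; 3F)
open import Data.Fin.Properties using (toℕ-injective; toℕ-fromℕ<; toℕ<n; cantor-schröder-bernstein)
open import Data.Product using (_×_; _,_; proj₁; proj₂; ∃-syntax; swap)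
open import Data.Sum as ⊎ using (_⊎_; inj₁; inj₂)
open import Data.Empty using (⊥; ⊥-elim)
open import Data.Unit using (tt)
open import Function using (flip; _∘_)
open import Function.Definitions using (Injective)
open import Relation.Binary using (tri<; tri≈; tri>)
open import Relation.Nullary using (¬_; yes; no)
open import Relation.Nullary.Decidable using (decidable-stable; _⊎-dec_)
open import Relation.Binary.PropositionalEquality using (_≡_; _≢_; refl; sym; trans; cong; subst; subst₂)

open IsLocalTournamentCompletion

Restrict : ∀ {n} → VSet n → (Fin n → Fin n → Set) → Fin n → Fin n → Set
Restrict P O u v = P u × P v × O u v

Sink Source : ∀ {n} → (Fin n → Fin n → Set) → Fin n → Set
Sink O w = ∀ {x} → ¬ O w x
Source O w = ∀ {x} → ¬ O x w

Nonadjacent : ∀ {n} → POG n → Fin n → Fin n → Set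
Nonadjacent H t x = t ≢ x × ¬ adj H t x

ArcsWithin : ∀ {n} → POG n → VSet n → Set
ArcsWithin H P = ∀ {u v} → arc H u v → P u × P v

ArcTouching : ∀ {n} → POG n → VSet n → Set
ArcTouching H P = ∃[ u ] ∃[ v ] (arc H u v × (P u ⊎ P v))

injection-onto⇒≡ : ∀ {m n} (f : Fin m → Fin n) → Injective _≡_ _≡_ f →
                   (∀ z → ∃[ i ] f i ≡ z) → m ≡ n
injection-onto⇒≡ f f-injective onto = cantor-schröder-bernstein f-injective g-injective
  where
  g-injective : Injective _≡_ _≡_ (proj₁ ∘ onto)
  g-injective {z} {z′} e = trans (sym (proj₂ (onto z))) (trans (cong f e) (proj₂ (onto z′)))

module _ {n} {a b c d : Fin n}
  (a≢b : a ≢ b) (a≢c : a ≢ c) (a≢d : a ≢ d) (b≢c : b ≢ c) (b≢d : b ≢ d) (c≢d : c ≢ d) where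

  private
    choose : Fin 4 → Fin n
    choose 0F = a
    choose 1F = b
    choose 2F = c
    choose 3F = d

    choose-injective : Injective _≡_ _≡_ choose
    choose-injective {0F} {0F} _ = refl
    choose-injective {0F} {1F} e = ⊥-elim (a≢b e)
    choose-injective {0F} {2F} e = ⊥-elim (a≢c e)
    choose-injective {0F} {3F} e = ⊥-elim (a≢d e)
    choose-injective {1F} {0F} e = ⊥-elim (a≢b (sym e))
    choose-injective {1F} {1F} _ = refl
    choose-injective {1F} {2F} e = ⊥-elim (b≢c e)
    choose-injective {1F} {3F} e = ⊥-elim (b≢d e)
    choose-injective {2F} {0F} e = ⊥-elim (a≢c (sym e))
    choose-injective {2F} {1F} e = ⊥-elim (b≢c (sym e))
    choose-injective {2F} {2F} _ = refl
    choose-injective {2F} {3F} e = ⊥-elim (c≢d e)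
    choose-injective {3F} {0F} e = ⊥-elim (a≢d (sym e))
    choose-injective {3F} {1F} e = ⊥-elim (b≢d (sym e))
    choose-injective {3F} {2F} e = ⊥-elim (c≢d (sym e))
    choose-injective {3F} {3F} _ = refl

  four-distinct-spanning⇒≡4 : (∀ z → z ≡ a ⊎ z ≡ b ⊎ z ≡ c ⊎ z ≡ d) → n ≡ 4
  four-distinct-spanning⇒≡4 spanning = sym (injection-onto⇒≡ choose choose-injective onto)
    where
    onto : ∀ z → ∃[ i ] choose i ≡ z
    onto z with spanning z
    ... | inj₁ z≡a = 0F , sym z≡a
    ... | inj₂ (inj₁ z≡b) = 1F , sym z≡b
    ... | inj₂ (inj₂ (inj₁ z≡c)) = 2F , sym z≡c
    ... | inj₂ (inj₂ (inj₂ z≡d)) = 3F , sym z≡d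

module _ {n} {H : POG n} where

  reach-edge : ∀ {S x y} → S x → S y → adj H x y → Reach H S x y
  reach-edge sx sy x~y = step sx x~y (here sy)

  reach-++ : ∀ {S x y z} → Reach H S x y → Reach H S y z → Reach H S x z
  reach-++ (here _) r = r
  reach-++ (step sx e r) r′ = step sx e (reach-++ r r′)

  linked-neighbours⇒¬cut-vertex : ∀ {v} →
    (∀ {a b} → a ≢ v → b ≢ v → adj H a v → adj H b v → Reach H (minus v) a b) →
    ¬ IsCutVertex H v
  linked-neighbours⇒¬cut-vertex {v} linked (x , y , x≢v , y≢v , walk , ¬walk) = ¬walk (avoid x≢v y≢v walk)
    where
    avoid : ∀ {x y} → x ≢ v → y ≢ v → Reach H everything x y → Reach H (minus v) x y
    avoid-from : ∀ {x y} → x ≢ v → adj H x v → y ≢ v → Reach H everything v y → Reach H (minus v) x y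
    avoid x≢v y≢v (here _) = here x≢v
    avoid x≢v y≢v (step {y = x₁} _ x~x₁ r) with x₁ ≟ v
    ... | yes refl = avoid-from x≢v x~x₁ y≢v r
    ... | no x₁≢v = step x≢v x~x₁ (avoid x₁≢v y≢v r)
    avoid-from x≢v x~v y≢v (here _) = ⊥-elim (y≢v refl)
    avoid-from x≢v x~v y≢v (step {y = x₁} _ v~x₁ r) =
      reach-++ (linked x≢v x₁≢v x~v (adj-sym H v~x₁)) (avoid x₁≢v y≢v r)
      where
      x₁≢v : x₁ ≢ v
      x₁≢v refl = adj-irr H v~x₁

  restrict : ∀ {S P O} → IsLocalTournamentCompletion H S O → (∀ {u} → P u → S u) →
             IsLocalTournamentCompletion H P (Restrict P O)
  restrict T P⊆S = record
    { O-in-S  = λ (pu , pv , _) → pu , pv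
    ; O-adj   = λ (_ , _ , o) → O-adj T o
    ; O-total = λ pu pv e → ⊎.map (λ o → pu , pv , o) (λ o → pv , pu , o) (O-total T (P⊆S pu) (P⊆S pv) e)
    ; O-asym  = λ (_ , _ , o) (_ , _ , o′) → O-asym T o o′
    ; O-arc   = λ pu pv a → pu , pv , O-arc T (P⊆S pu) (P⊆S pv) a
    ; O-out   = λ x≢y (_ , _ , o) (_ , _ , o′) → O-out T x≢y o o′
    ; O-in    = λ x≢y (_ , _ , o) (_ , _ , o′) → O-in T x≢y o o′
    }

  reverse : ∀ {S O} → IsLocalTournamentCompletion H S O → (∀ {u v} → S u → S v → ¬ arc H u v) →
            IsLocalTournamentCompletion H S (flip O)
  reverse T arc-free = record
    { O-in-S  = swap ∘ O-in-S T
    ; O-adj   = adj-sym H ∘ O-adj T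
    ; O-total = λ su sv e → O-total T sv su (adj-sym H e)
    ; O-asym  = O-asym T
    ; O-arc   = λ su sv a → ⊥-elim (arc-free su sv a)
    ; O-out   = O-in T
    ; O-in    = O-out T
    }

  ¬middle-neighbour-apart-from-ends : ∀ {S O t w x y} → IsLocalTournamentCompletion H S O → S t → S w →
    O y w → O w x → adj H t w → Nonadjacent H t x → Nonadjacent H t y → ⊥
  ¬middle-neighbour-apart-from-ends T st sw oyw owx t~w (t≢x , t≁x) (t≢y , t≁y) with O-total T st sw t~w
  ... | inj₁ otw = t≁y (O-in T t≢y otw oyw)
  ... | inj₂ owt = t≁x (O-out T t≢x owt owx)

  O-irrefl : ∀ {S O u} → IsLocalTournamentCompletion H S O → ¬ O u u
  O-irrefl T o = O-asym T o o

  sink-or-source : ∀ {S O P w r} → IsLocalTournamentCompletion H S O → (∀ {u} → P u → S u) →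
    P w → S r → ¬ P r → adj H w r → (∀ {x} → P x → adj H x r → x ≡ w) →
    Sink (Restrict P O) w ⊎ Source (Restrict P O) w
  sink-or-source {O = O} {w = w} T P⊆S pw sr ¬pr w~r only-w with O-total T (P⊆S pw) sr w~r
  ... | inj₁ owr = inj₁ λ (_ , px , owx) →
    O-irrefl T (subst (O w) (only-w px (O-out T (λ { refl → ¬pr px }) owx owr)) owx)
  ... | inj₂ orw = inj₂ λ (px , _ , oxw) →
    O-irrefl T (subst (λ z → O z w) (only-w px (O-in T (λ { refl → ¬pr px }) oxw orw)) oxw)

module _ {n} {X : POG n} where

  completion-orienting⇒completion : ∀ {a b S O} → IsLocalTournamentCompletion (unorient X a b) S O →
    O a b → IsLocalTournamentCompletion X S O
  completion-orienting⇒completion {a} {b} {S} {O} T oab =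
    record { IsLocalTournamentCompletion T hiding (O-arc) ; O-arc = O-arc′ }
    where
    O-arc′ : ∀ {u v} → S u → S v → arc X u v → O u v
    O-arc′ {u} {v} su sv uv with u ≟ a | v ≟ b
    ... | yes refl | yes refl = oab
    ... | no u≢a   | _        = O-arc T su sv (uv , λ (u≡a , _) → u≢a u≡a)
    ... | yes _    | no v≢b   = O-arc T su sv (uv , λ (_ , v≡b) → v≢b v≡b)

  module _ (ob : Obstruction X) where
    open Obstruction ob

    obstruction-has-second-arc : ∀ {a b} → arc X a b → ¬ ¬ (∃[ u ] ∃[ v ] (arc X u v × ¬ (u ≡ a × v ≡ b)))
    obstruction-has-second-arc ab alone with minus-arc ab
    ... | O , T with O-total T tt tt (arc-adj X ab)
    ...   | inj₁ oab = not-completable (O , completion-orienting⇒completion T oab)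
    ...   | inj₂ oba = not-completable
      (flip O , completion-orienting⇒completion (reverse T λ _ _ (uv , other) → alone (_ , _ , uv , other)) oba)

    ¬out-arcs-with-apart-neighbour : ∀ {w x y t} → arc X w x → arc X w y → x ≢ y →
      adj X t w → Nonadjacent X t x → Nonadjacent X t y → ⊥
    ¬out-arcs-with-apart-neighbour wx wy x≢y t~w t≁x t≁y with minus-arc wx
    ... | O , T with O-total T tt tt (arc-adj X wx)
    ...   | inj₁ owx = not-completable (O , completion-orienting⇒completion T owx)
    ...   | inj₂ oxw = ¬middle-neighbour-apart-from-ends T tt tt oxw
      (O-arc T tt tt (wy , λ (_ , y≡x) → x≢y (sym y≡x))) t~w t≁y t≁x

    ¬in-arcs-with-apart-neighbour : ∀ {w x y t} → arc X x w → arc X y w → x ≢ y →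
      adj X t w → Nonadjacent X t x → Nonadjacent X t y → ⊥
    ¬in-arcs-with-apart-neighbour xw yw x≢y t~w t≁x t≁y with minus-arc xw
    ... | O , T with O-total T tt tt (arc-adj X xw)
    ...   | inj₁ oxw = not-completable (O , completion-orienting⇒completion T oxw)
    ...   | inj₂ owx = ¬middle-neighbour-apart-from-ends T tt tt
      (O-arc T tt tt (yw , λ (y≡x , _) → x≢y (sym y≡x))) owx t~w t≁x t≁y

    through-arcs-with-apart-neighbour⇒≡4 : ∀ {w x y t} → arc X w x → arc X y w →
      adj X t w → Nonadjacent X t x → Nonadjacent X t y → n ≡ 4
    through-arcs-with-apart-neighbour⇒≡4 {w} {x} {y} {t} wx yw t~w t≁x t≁y =
      four-distinct-spanning⇒≡4 w≢x w≢y w≢t x≢y (proj₁ t≁x ∘ sym) (proj₁ t≁y ∘ sym) spanning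
      where
      w≢x : w ≢ x
      w≢x refl = adj-irr X (arc-adj X wx)
      w≢y : w ≢ y
      w≢y refl = adj-irr X (arc-adj X yw)
      w≢t : w ≢ t
      w≢t refl = adj-irr X t~w
      x≢y : x ≢ y
      x≢y refl = arc-asym X wx yw
      spanning : ∀ z → z ≡ w ⊎ z ≡ x ⊎ z ≡ y ⊎ z ≡ t
      spanning z with z ≟ w ⊎-dec z ≟ x ⊎-dec z ≟ y ⊎-dec z ≟ t
      ... | yes one-of-them = one-of-them
      ... | no z-new with minus-vertex z
      ...   | O , T = ⊥-elim (¬middle-neighbour-apart-from-ends T (kept (inj₂ ∘ inj₂ ∘ inj₂)) (kept inj₁)
        (O-arc T (kept (inj₂ ∘ inj₂ ∘ inj₁)) (kept inj₁) yw) (O-arc T (kept inj₁) (kept (inj₂ ∘ inj₁)) wx)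
        t~w t≁x t≁y)
        where
        kept : ∀ {u} → (z ≡ u → z ≡ w ⊎ z ≡ x ⊎ z ≡ y ⊎ z ≡ t) → u ≢ z
        kept which u≡z = z-new (which (sym u≡z))

Balanced : ∀ {n} → (Fin n → Fin n → Set) → (Fin n → Fin n → Set) → Fin n → Set
Balanced O₁ O₂ w = (Sink O₁ w × Source O₂ w) ⊎ (Source O₁ w × Sink O₂ w)

balanced-or-reversible : ∀ {n} {O₁ O₂ : Fin n → Fin n → Set} {w} →
  Sink O₁ w ⊎ Source O₁ w → Sink O₂ w ⊎ Source O₂ w → Balanced O₁ O₂ w ⊎ Balanced O₁ (flip O₂) w
balanced-or-reversible (inj₁ sink₁)   (inj₁ sink₂)   = inj₂ (inj₁ (sink₁ , sink₂))
balanced-or-reversible (inj₁ sink₁)   (inj₂ source₂) = inj₁ (inj₁ (sink₁ , source₂))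
balanced-or-reversible (inj₂ source₁) (inj₁ sink₂)   = inj₁ (inj₂ (source₁ , sink₂))
balanced-or-reversible (inj₂ source₁) (inj₂ source₂) = inj₂ (inj₂ (source₁ , source₂))

module CutDecomposition {n} (X : POG n) (L R : VSet n) (w : Fin n)
  (L∩R : ∀ {u} → L u → R u → u ≡ w) (w∈L : L w) (w∈R : R w)
  (edge-inside : ∀ {u v} → adj X u v → (L u × L v) ⊎ (R u × R v)) where

  -- Deleting z leaves a completion of the side P, in which r, a neighbour of w off that side, survives.
  OutsideNeighbour : VSet n → Set
  OutsideNeighbour P = ∃[ z ] ∃[ r ] (¬ P z × ¬ P r × r ≢ z × adj X w r)

  glue : ∀ {O₁ O₂} → IsLocalTournamentCompletion X L O₁ → IsLocalTournamentCompletion X R O₂ →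
         Balanced O₁ O₂ w → Completable X
  glue {O₁} {O₂} T₁ T₂ balanced = (λ u v → O₁ u v ⊎ O₂ u v) , record
    { O-in-S  = λ _ → tt , tt
    ; O-adj   = ⊎.[ O-adj T₁ , O-adj T₂ ]
    ; O-total = λ _ _ e → ⊎.[ (λ (lu , lv) → ⊎.map inj₁ inj₁ (O-total T₁ lu lv e))
                            , (λ (ru , rv) → ⊎.map inj₂ inj₂ (O-total T₂ ru rv e)) ] (edge-inside e)
    ; O-asym  = λ { (inj₁ o) (inj₁ o′) → O-asym T₁ o o′
                  ; (inj₂ o) (inj₂ o′) → O-asym T₂ o o′
                  ; (inj₁ o) (inj₂ o′) → crossing-asym o o′
                  ; (inj₂ o) (inj₁ o′) → crossing-asym o′ o }
    ; O-arc   = λ _ _ uv → ⊎.[ (λ (lu , lv) → inj₁ (O-arc T₁ lu lv uv))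
                             , (λ (ru , rv) → inj₂ (O-arc T₂ ru rv uv)) ] (edge-inside (arc-adj X uv))
    ; O-out   = λ { x≢y (inj₁ o) (inj₁ o′) → O-out T₁ x≢y o o′
                  ; x≢y (inj₂ o) (inj₂ o′) → O-out T₂ x≢y o o′
                  ; _   (inj₁ o) (inj₂ o′) → ⊥-elim (crossing-out o o′)
                  ; _   (inj₂ o) (inj₁ o′) → ⊥-elim (crossing-out o′ o) }
    ; O-in    = λ { x≢y (inj₁ o) (inj₁ o′) → O-in T₁ x≢y o o′
                  ; x≢y (inj₂ o) (inj₂ o′) → O-in T₂ x≢y o o′
                  ; _   (inj₁ o) (inj₂ o′) → ⊥-elim (crossing-in o o′)
                  ; _   (inj₂ o) (inj₁ o′) → ⊥-elim (crossing-in o′ o) }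
    }
    where
    crossing-asym : ∀ {u v} → O₁ u v → ¬ O₂ v u
    crossing-asym o₁ o₂ with L∩R (proj₁ (O-in-S T₁ o₁)) (proj₂ (O-in-S T₂ o₂))
                           | L∩R (proj₂ (O-in-S T₁ o₁)) (proj₁ (O-in-S T₂ o₂))
    ... | refl | refl = O-irrefl T₁ o₁

    crossing-out : ∀ {u x y} → O₁ u x → O₂ u y → ⊥
    crossing-out o₁ o₂ with L∩R (proj₁ (O-in-S T₁ o₁)) (proj₁ (O-in-S T₂ o₂))
    ... | refl = ⊎.[ (λ (sink₁ , _) → sink₁ o₁) , (λ (_ , sink₂) → sink₂ o₂) ] balanced

    crossing-in : ∀ {u x y} → O₁ x u → O₂ y u → ⊥
    crossing-in o₁ o₂ with L∩R (proj₂ (O-in-S T₁ o₁)) (proj₂ (O-in-S T₂ o₂))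
    ... | refl = ⊎.[ (λ (_ , source₂) → source₂ o₂) , (λ (source₁ , _) → source₁ o₁) ] balanced

  private
    only-w-in-L : ∀ {x r} → L x → ¬ L r → adj X x r → x ≡ w
    only-w-in-L lx ¬lr x~r = ⊎.[ (λ (_ , lr) → ⊥-elim (¬lr lr)) , (λ (rx , _) → L∩R lx rx) ] (edge-inside x~r)

    only-w-in-R : ∀ {x r} → R x → ¬ R r → adj X x r → x ≡ w
    only-w-in-R rx ¬rr x~r = ⊎.[ (λ (lx , _) → L∩R lx rx) , (λ (_ , rr) → ⊥-elim (¬rr rr)) ] (edge-inside x~r)

    arc-free-beside : ∀ {P Q : VSet n} → (∀ {u} → P u → Q u → u ≡ w) → ArcsWithin X P →
                      ∀ {u v} → Q u → Q v → ¬ arc X u v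
    arc-free-beside P∩Q within qu qv uv with P∩Q (proj₁ (within uv)) qu | P∩Q (proj₂ (within uv)) qv
    ... | refl | refl = adj-irr X (arc-adj X uv)

  module _ (ob : Obstruction X) where

    side-completion : ∀ {P} → P w → (∀ {x r} → P x → ¬ P r → adj X x r → x ≡ w) → OutsideNeighbour P →
      ∃[ O ] (IsLocalTournamentCompletion X P O × (Sink O w ⊎ Source O w))
    side-completion {P} pw only-w (z , r , ¬pz , ¬pr , r≢z , w~r) with Obstruction.minus-vertex ob z
    ... | O , T = Restrict P O , restrict T P⊆X-z , sink-or-source T P⊆X-z pw r≢z ¬pr w~r (λ px → only-w px ¬pr)
      where
      P⊆X-z : ∀ {u} → P u → u ≢ z
      P⊆X-z pu refl = ¬pz pu

    ¬arcs-on-one-side : OutsideNeighbour L → OutsideNeighbour R → ¬ (ArcsWithin X L ⊎ ArcsWithin X R)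
    ¬arcs-on-one-side outside-L outside-R within
      with side-completion w∈L only-w-in-L outside-L | side-completion w∈R only-w-in-R outside-R
    ... | O₁ , T₁ , s₁ | O₂ , T₂ , s₂ =
      Obstruction.not-completable ob (completion (balanced-or-reversible {O₁ = O₁} {O₂} s₁ s₂) within)
      where
      completion : Balanced O₁ O₂ w ⊎ Balanced O₁ (flip O₂) w → ArcsWithin X L ⊎ ArcsWithin X R → Completable X
      completion (inj₁ b) _            = glue T₁ T₂ b
      completion (inj₂ b) (inj₁ in-L) = glue T₁ (reverse T₂ (arc-free-beside L∩R in-L)) b
      completion (inj₂ b) (inj₂ in-R) = glue (reverse T₁ (arc-free-beside (flip L∩R) in-R)) T₂ (⊎.swap b)

module Enumeration {n} (X : POG n) (σ : Fin n → Fin n) (enumeration : IsStraightEnumeration X σ) (c : Fin n)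
  where

  pos : Fin n → Fin n
  pos u = proj₁ (proj₂ (proj₁ enumeration) u)

  σ-pos : ∀ u → σ (pos u) ≡ u
  σ-pos u = proj₂ (proj₂ (proj₁ enumeration) u) refl

  -- Ranks are 0-based: the paper's v_i has rank i − 1, so c = 2 and c = n − 1 read toℕ c ≡ 1 and toℕ c ≡ n ∸ 2.
  rank : Fin n → ℕ
  rank u = toℕ (pos u)

  rank-injective : ∀ {u v} → rank u ≡ rank v → u ≡ v
  rank-injective {u} {v} e = trans (sym (σ-pos u)) (trans (cong σ (toℕ-injective e)) (σ-pos v))

  rank-σ : ∀ i → rank (σ i) ≡ toℕ i
  rank-σ i = cong toℕ (proj₁ (proj₁ enumeration) (σ-pos (σ i)))

  vertex-at : (k : ℕ) → k < n → Fin n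
  vertex-at k k<n = σ (fromℕ< k<n)

  rank-vertex-at : ∀ {k} (k<n : k < n) → rank (vertex-at k k<n) ≡ k
  rank-vertex-at k<n = trans (rank-σ (fromℕ< k<n)) (toℕ-fromℕ< k<n)

  straight : ∀ {u v w} → rank u < rank v → rank v < rank w → adj X u w → adj X u v × adj X v w
  straight {u} {v} {w} u<v v<w u~w
    with proj₂ enumeration (pos u) (pos v) (pos w) u<v v<w (subst₂ (adj X) (sym (σ-pos u)) (sym (σ-pos w)) u~w)
  ... | u~v , v~w = subst₂ (adj X) (σ-pos u) (σ-pos v) u~v , subst₂ (adj X) (σ-pos v) (σ-pos w) v~w

  straight-closer-left : ∀ {u v w} → rank u ≤ rank v → rank v < rank w → adj X u w → adj X v w
  straight-closer-left u≤v v<w u~w with m≤n⇒m<n∨m≡n u≤v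
  ... | inj₁ u<v = proj₂ (straight u<v v<w u~w)
  ... | inj₂ u≡v = subst (λ x → adj X x _) (rank-injective u≡v) u~w

  straight-closer-right : ∀ {u v w} → rank u < rank v → rank v ≤ rank w → adj X u w → adj X u v
  straight-closer-right u<v v≤w u~w with m≤n⇒m<n∨m≡n v≤w
  ... | inj₁ v<w = proj₁ (straight u<v v<w u~w)
  ... | inj₂ v≡w = subst (adj X _) (rank-injective (sym v≡w)) u~w

  vc : Fin n
  vc = σ c

  Before After Left Right : VSet n
  Before u = rank u < toℕ c
  After  u = toℕ c < rank u
  Left   u = rank u ≤ toℕ c
  Right  u = toℕ c ≤ rank u

  before<vc : ∀ {u} → Before u → rank u < rank vc
  before<vc = subst (_ <_) (sym (rank-σ c))

  vc<after : ∀ {u} → After u → rank vc < rank u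
  vc<after = subst (_< _) (sym (rank-σ c))

  before⇒≢vc : ∀ {u} → Before u → u ≢ vc
  before⇒≢vc bu refl = <-irrefl (rank-σ c) bu

  after⇒≢vc : ∀ {u} → After u → u ≢ vc
  after⇒≢vc au refl = <-irrefl (sym (rank-σ c)) au

  ≢vc⇒before-or-after : ∀ {u} → u ≢ vc → Before u ⊎ After u
  ≢vc⇒before-or-after {u} u≢vc with <-cmp (rank u) (toℕ c)
  ... | tri< bu _ _ = inj₁ bu
  ... | tri≈ _ u≡c _ = ⊥-elim (u≢vc (rank-injective (trans u≡c (sym (rank-σ c)))))
  ... | tri> _ _ au = inj₂ au

  ArcWithVc : Fin n → Set
  ArcWithVc x = arc X vc x ⊎ arc X x vc

  arc-with-vc⇒≢vc : ∀ {x} → ArcWithVc x → x ≢ vc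
  arc-with-vc⇒≢vc (inj₁ vcx) refl = adj-irr X (arc-adj X vcx)
  arc-with-vc⇒≢vc (inj₂ xvc) refl = adj-irr X (arc-adj X xvc)

  arc-with-vc-touching : ∀ {P x} → ArcWithVc x → P x → ArcTouching X P
  arc-with-vc-touching (inj₁ vcx) px = _ , _ , vcx , inj₂ px
  arc-with-vc-touching (inj₂ xvc) px = _ , _ , xvc , inj₁ px

  module _ (cut : IsCutVertex X vc) where

    linked-by-rank : ∀ {a b} → a ≢ vc → b ≢ vc →
      (rank a < rank b → adj X a b) → (rank b < rank a → adj X b a) → Reach X (minus vc) a b
    linked-by-rank {a} {b} a≢vc b≢vc a<b⇒a~b b<a⇒b~a with <-cmp (rank a) (rank b)
    ... | tri< a<b _ _ = reach-edge a≢vc b≢vc (a<b⇒a~b a<b)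
    ... | tri≈ _ a≡b _ = subst (Reach X (minus vc) a) (rank-injective a≡b) (here a≢vc)
    ... | tri> _ _ b<a = reach-edge a≢vc b≢vc (adj-sym X (b<a⇒b~a b<a))

    before-neighbours-linked : ∀ {a b} → Before a → Before b → adj X a vc → adj X b vc → Reach X (minus vc) a b
    before-neighbours-linked ba bb a~vc b~vc = linked-by-rank (before⇒≢vc ba) (before⇒≢vc bb)
      (λ a<b → proj₁ (straight a<b (before<vc bb) a~vc)) (λ b<a → proj₁ (straight b<a (before<vc ba) b~vc))

    after-neighbours-linked : ∀ {a b} → After a → After b → adj X a vc → adj X b vc → Reach X (minus vc) a b
    after-neighbours-linked aa ab a~vc b~vc = linked-by-rank (after⇒≢vc aa) (after⇒≢vc ab)
      (λ a<b → proj₂ (straight (vc<after aa) a<b (adj-sym X b~vc)))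
      (λ b<a → proj₂ (straight (vc<after ab) b<a (adj-sym X a~vc)))

    no-crossing : ∀ {u w} → Before u → After w → ¬ adj X u w
    no-crossing {u} {w} bu aw u~w = linked-neighbours⇒¬cut-vertex linked cut
      where
      u~vc : adj X u vc
      u~vc = proj₁ (straight (before<vc bu) (vc<after aw) u~w)
      w~vc : adj X w vc
      w~vc = adj-sym X (proj₂ (straight (before<vc bu) (vc<after aw) u~w))
      linked : ∀ {a b} → a ≢ vc → b ≢ vc → adj X a vc → adj X b vc → Reach X (minus vc) a b
      linked a≢vc b≢vc a~vc b~vc with ≢vc⇒before-or-after a≢vc | ≢vc⇒before-or-after b≢vc
      ... | inj₁ ba | inj₁ bb = before-neighbours-linked ba bb a~vc b~vc
      ... | inj₂ aa | inj₂ ab = after-neighbours-linked aa ab a~vc b~vc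
      ... | inj₁ ba | inj₂ ab = reach-++ (before-neighbours-linked ba bu a~vc u~vc)
                                  (step (before⇒≢vc bu) u~w (after-neighbours-linked aw ab w~vc b~vc))
      ... | inj₂ aa | inj₁ bb = reach-++ (after-neighbours-linked aa aw a~vc w~vc)
                                  (step (after⇒≢vc aw) (adj-sym X u~w) (before-neighbours-linked bu bb u~vc b~vc))

    has-neighbour-before : ¬ ¬ (∃[ l ] (Before l × adj X l vc))
    has-neighbour-before none = linked-neighbours⇒¬cut-vertex linked cut
      where
      linked : ∀ {a b} → a ≢ vc → b ≢ vc → adj X a vc → adj X b vc → Reach X (minus vc) a b
      linked a≢vc b≢vc a~vc b~vc with ≢vc⇒before-or-after a≢vc | ≢vc⇒before-or-after b≢vc
      ... | inj₁ ba | _       = ⊥-elim (none (_ , ba , a~vc))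
      ... | inj₂ _  | inj₁ bb = ⊥-elim (none (_ , bb , b~vc))
      ... | inj₂ aa | inj₂ ab = after-neighbours-linked aa ab a~vc b~vc

    has-neighbour-after : ¬ ¬ (∃[ r ] (After r × adj X vc r))
    has-neighbour-after none = linked-neighbours⇒¬cut-vertex linked cut
      where
      linked : ∀ {a b} → a ≢ vc → b ≢ vc → adj X a vc → adj X b vc → Reach X (minus vc) a b
      linked a≢vc b≢vc a~vc b~vc with ≢vc⇒before-or-after a≢vc | ≢vc⇒before-or-after b≢vc
      ... | inj₂ aa | _       = ⊥-elim (none (_ , aa , adj-sym X a~vc))
      ... | inj₁ _  | inj₂ ab = ⊥-elim (none (_ , ab , adj-sym X b~vc))
      ... | inj₁ ba | inj₁ bb = before-neighbours-linked ba bb a~vc b~vc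

    ¬edge-across : ∀ {u v} → adj X u v → Before u ⊎ Before v → After u ⊎ After v → ⊥
    ¬edge-across u~v (inj₁ bu) (inj₁ au) = <-asym bu au
    ¬edge-across u~v (inj₁ bu) (inj₂ av) = no-crossing bu av u~v
    ¬edge-across u~v (inj₂ bv) (inj₁ au) = no-crossing bv au (adj-sym X u~v)
    ¬edge-across u~v (inj₂ bv) (inj₂ av) = <-asym bv av

    nonadjacent-before-after : ∀ {t x} → Before t → After x → Nonadjacent X t x
    nonadjacent-before-after bt ax = (λ { refl → <-asym bt ax }) , no-crossing bt ax

    nonadjacent-after-before : ∀ {t x} → After t → Before x → Nonadjacent X t x
    nonadjacent-after-before at bx = (λ { refl → <-asym bx at }) , λ t~x → no-crossing bx at (adj-sym X t~x)

    private
      left-right-edge : ∀ {u v} → Left u → Right v → adj X u v → (Left u × Left v) ⊎ (Right u × Right v)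
      left-right-edge lu rv u~v with m≤n⇒m<n∨m≡n lu | m≤n⇒m<n∨m≡n rv
      ... | inj₂ u≡c | _        = inj₂ (≤-reflexive (sym u≡c) , rv)
      ... | inj₁ _   | inj₂ c≡v = inj₁ (lu , ≤-reflexive (sym c≡v))
      ... | inj₁ bu  | inj₁ av  = ⊥-elim (no-crossing bu av u~v)

    edge-inside : ∀ {u v} → adj X u v → (Left u × Left v) ⊎ (Right u × Right v)
    edge-inside {u} {v} u~v with ≤-total (rank u) (toℕ c) | ≤-total (toℕ c) (rank v)
    ... | inj₁ lu | inj₂ lv = inj₁ (lu , lv)
    ... | inj₂ ru | inj₁ rv = inj₂ (ru , rv)
    ... | inj₁ lu | inj₁ rv = left-right-edge lu rv u~v
    ... | inj₂ ru | inj₂ lv = ⊎.map swap swap (left-right-edge lv ru (adj-sym X u~v))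

    open CutDecomposition X Left Right vc
      (λ lu ru → rank-injective (trans (≤-antisym lu ru) (sym (rank-σ c))))
      (≤-reflexive (rank-σ c)) (≤-reflexive (sym (rank-σ c))) edge-inside

    outside-Right : toℕ c ≢ 1 → ∃[ l ] (Before l × adj X l vc) → OutsideNeighbour Right
    outside-Right c≢1 (l , bl , l~vc) =
      first , previous , <⇒≱ first-before , <⇒≱ previous-before , previous≢first ,
      adj-sym X (straight-closer-left l≤previous (before<vc previous-before) l~vc)
      where
      0<c : 0 < toℕ c
      0<c = m<n⇒0<n bl
      suc-pred-c : suc (pred (toℕ c)) ≡ toℕ c
      suc-pred-c = suc-pred (toℕ c) {{>-nonZero 0<c}}
      pred-c<c : pred (toℕ c) < toℕ c
      pred-c<c = subst (pred (toℕ c) <_) suc-pred-c (n<1+n _)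
      first<n : 0 < n
      first<n = <-trans 0<c (toℕ<n c)
      previous<n : pred (toℕ c) < n
      previous<n = <-trans pred-c<c (toℕ<n c)
      first previous : Fin n
      first = vertex-at 0 first<n
      previous = vertex-at (pred (toℕ c)) previous<n
      first-before : Before first
      first-before = subst (_< toℕ c) (sym (rank-vertex-at first<n)) 0<c
      previous-before : Before previous
      previous-before = subst (_< toℕ c) (sym (rank-vertex-at previous<n)) pred-c<c
      l≤previous : rank l ≤ rank previous
      l≤previous = subst (rank l ≤_) (sym (rank-vertex-at previous<n)) (<⇒≤pred bl)
      previous≢first : previous ≢ first
      previous≢first e = c≢1 (trans (sym suc-pred-c) (cong suc
        (trans (sym (rank-vertex-at previous<n)) (trans (cong rank e) (rank-vertex-at first<n)))))

    outside-Left : toℕ c ≢ n ∸ 2 → ∃[ r ] (After r × adj X vc r) → OutsideNeighbour Left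
    outside-Left c≢n-2 (r , ar , vc~r) =
      beyond , next , <⇒≱ beyond-after , <⇒≱ next-after , next≢beyond ,
      straight-closer-right (vc<after next-after) next≤r vc~r
      where
      next<n : suc (toℕ c) < n
      next<n = ≤-<-trans ar (toℕ<n (pos r))
      beyond<n : suc (suc (toℕ c)) < n
      beyond<n = 2+m<n next<n c≢n-2
        where
        2+m<n : ∀ {m n} → suc m < n → m ≢ n ∸ 2 → suc (suc m) < n
        2+m<n {n = suc (suc _)} (s≤s (s≤s m≤n-2)) m≢n-2 = s≤s (s≤s (≤∧≢⇒< m≤n-2 m≢n-2))
      next beyond : Fin n
      next = vertex-at (suc (toℕ c)) next<n
      beyond = vertex-at (suc (suc (toℕ c))) beyond<n
      next-after : After next
      next-after = subst (toℕ c <_) (sym (rank-vertex-at next<n)) (n<1+n _)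
      beyond-after : After beyond
      beyond-after = subst (toℕ c <_) (sym (rank-vertex-at beyond<n)) (<-trans (n<1+n _) (n<1+n _))
      next≤r : rank next ≤ rank r
      next≤r = subst (_≤ rank r) (sym (rank-vertex-at next<n)) ar
      next≢beyond : next ≢ beyond
      next≢beyond e = <⇒≢ (n<1+n _)
        (trans (sym (rank-vertex-at next<n)) (trans (cong rank e) (rank-vertex-at beyond<n)))

    module _ (non-dividing : ¬ Dividing X σ c) where

      ¬arcs-touching-both-sides : ¬ (ArcTouching X Before × ArcTouching X After)
      ¬arcs-touching-both-sides ((u , v , uv , touch-before) , (u′ , v′ , u′v′ , touch-after)) =
        non-dividing (u , v , u′ , v′ , uv , u′v′ , distinct ,
                      ⊎.map precedes precedes touch-before , ⊎.map succeeds succeeds touch-after)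
        where
        precedes : ∀ {x} → Before x → Precedes σ x c
        precedes {x} bx = pos x , bx , σ-pos x
        succeeds : ∀ {x} → After x → Succeeds σ x c
        succeeds {x} ax = pos x , ax , σ-pos x
        distinct : ¬ (u ≡ u′ × v ≡ v′)
        distinct (refl , refl) = ¬edge-across (arc-adj X uv) touch-before touch-after

      ¬touching-after⇒within-Left : ¬ ArcTouching X After → ArcsWithin X Left
      ¬touching-after⇒within-Left none uv =
        ≮⇒≥ (λ au → none (_ , _ , uv , inj₁ au)) , ≮⇒≥ (λ av → none (_ , _ , uv , inj₂ av))

      ¬touching-before⇒within-Right : ¬ ArcTouching X Before → ArcsWithin X Right
      ¬touching-before⇒within-Right none uv =
        ≮⇒≥ (λ bu → none (_ , _ , uv , inj₁ bu)) , ≮⇒≥ (λ bv → none (_ , _ , uv , inj₂ bv))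

      common-apart-neighbour : ∀ {x y} → ArcWithVc x → ArcWithVc y →
        ¬ ¬ (∃[ t ] (adj X t vc × Nonadjacent X t x × Nonadjacent X t y))
      common-apart-neighbour x-vc y-vc found
        with ≢vc⇒before-or-after (arc-with-vc⇒≢vc x-vc) | ≢vc⇒before-or-after (arc-with-vc⇒≢vc y-vc)
      ... | inj₁ bx | inj₁ by = has-neighbour-after λ (t , at , vc~t) →
        found (t , adj-sym X vc~t , nonadjacent-after-before at bx , nonadjacent-after-before at by)
      ... | inj₂ ax | inj₂ ay = has-neighbour-before λ (t , bt , t~vc) →
        found (t , t~vc , nonadjacent-before-after bt ax , nonadjacent-before-after bt ay)
      ... | inj₁ bx | inj₂ ay =
        ¬arcs-touching-both-sides (arc-with-vc-touching x-vc bx , arc-with-vc-touching y-vc ay)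
      ... | inj₂ ax | inj₁ by =
        ¬arcs-touching-both-sides (arc-with-vc-touching y-vc by , arc-with-vc-touching x-vc ax)

      module _ (ob : Obstruction X) where

        cut-position : toℕ c ≡ 1 ⊎ toℕ c ≡ n ∸ 2
        cut-position = decidable-stable (toℕ c ℕ.≟ 1 ⊎-dec toℕ c ℕ.≟ n ∸ 2) λ neither →
          has-neighbour-before λ l → has-neighbour-after λ r →
          let ¬one-sided = ¬arcs-on-one-side ob (outside-Left (neither ∘ inj₂) r)
                                                  (outside-Right (neither ∘ inj₁) l)
          in ¬one-sided (inj₁ (¬touching-after⇒within-Left λ touch-after →
             ¬one-sided (inj₂ (¬touching-before⇒within-Right λ touch-before →
             ¬arcs-touching-both-sides (touch-before , touch-after)))))

        arcs-at-vc⇒n≡4 : ContainsArcs X → (∀ {u v} → arc X u v → u ≡ vc ⊎ v ≡ vc) → n ≡ 4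
        arcs-at-vc⇒n≡4 (_ , _ , ab) at-vc = decidable-stable (n ℕ.≟ 4) λ n≢4 →
          obstruction-has-second-arc ob ab λ (_ , _ , a′b′ , distinct) →
          two-arcs ab a′b′ distinct (at-vc ab) (at-vc a′b′) n≢4
          where
          two-arcs : ∀ {u v u′ v′} → arc X u v → arc X u′ v′ → ¬ (u′ ≡ u × v′ ≡ v) →
                     u ≡ vc ⊎ v ≡ vc → u′ ≡ vc ⊎ v′ ≡ vc → ¬ ¬ n ≡ 4
          two-arcs vcx vcy distinct (inj₁ refl) (inj₁ refl) _ =
            common-apart-neighbour (inj₁ vcx) (inj₁ vcy) λ (_ , t~vc , t≁x , t≁y) →
            ¬out-arcs-with-apart-neighbour ob vcx vcy (λ { refl → distinct (refl , refl) }) t~vc t≁x t≁y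
          two-arcs xvc yvc distinct (inj₂ refl) (inj₂ refl) _ =
            common-apart-neighbour (inj₂ xvc) (inj₂ yvc) λ (_ , t~vc , t≁x , t≁y) →
            ¬in-arcs-with-apart-neighbour ob xvc yvc (λ { refl → distinct (refl , refl) }) t~vc t≁x t≁y
          two-arcs vcx yvc _ (inj₁ refl) (inj₂ refl) n≢4 =
            common-apart-neighbour (inj₁ vcx) (inj₂ yvc) λ (_ , t~vc , t≁x , t≁y) →
            n≢4 (through-arcs-with-apart-neighbour⇒≡4 ob vcx yvc t~vc t≁x t≁y)
          two-arcs yvc vcx _ (inj₂ refl) (inj₁ refl) n≢4 =
            common-apart-neighbour (inj₁ vcx) (inj₂ yvc) λ (_ , t~vc , t≁x , t≁y) →
            n≢4 (through-arcs-with-apart-neighbour⇒≡4 ob vcx yvc t~vc t≁x t≁y)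

lemma3p3 : (n : ℕ) (X : POG n) → Obstruction X → ContainsArcs X →
    (σ : Fin n → Fin n) → IsStraightEnumeration X σ →
    (c : Fin n) → IsCutVertex X (σ c) → ¬ Dividing X σ c →
    ((toℕ c ≡ 1 ⊎ toℕ c ≡ n ∸ 2) ×
     ((∀ {u v} → arc X u v → (u ≡ σ c ⊎ v ≡ σ c)) → n ≡ 4))
lemma3p3 n X ob has-arcs σ enumeration c cut non-dividing =
  cut-position cut non-dividing ob , arcs-at-vc⇒n≡4 cut non-dividing ob has-arcs
  where open Enumeration X σ enumeration c
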